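{- Let $G$ be a finite simple graph with $n$ vertices and $m_G$ edges, and let $r$ be a restraint on $G$. Write, for all integers $x\geq M_{G,r}$, $$\pi_r(G,x)=\sum_{i=0}^n (-1)^{n-i}a_i(G,r)x^i .$$ Then $$a_{n-1}(G,r)=m_G+\sum_{u\in V(G)}|r(u)|.$$
   Context: A restraint $r$ on a graph $G$ is a function assigning to each vertex $v$ a finite set $r(v)\subset\mathbb{N}$ of forbidden colours. A proper $x$-colouring $c:V(G)\to\{1,\dots,x\}$ (adjacent vertices get different colours) is permitted by $r$ if $c(v)\notin r(v)$ for every vertex $v$. The restrained chromatic polynomial $\pi_r(G,x)$ is the number of proper $x$-colourings of $G$ permitted by $r$. $M_{G,r}$ denotes the maximum element of $\bigcup_{v\in V(G)}r(v)$ if this set is nonempty, and $0$ otherwise. It is known that for $x\geq M_{G,r}$, $\pi_r(G,x)$ agrees with a monic polynomial of degree $n$ in $x$ with integer coefficients; the $a_i(G,r)$ are defined via this polynomial. -}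

module Defs where

open import Data.Nat using (ℕ; zero; suc; _+_; _∸_; _⊔_; _≤_; _≟_; _≤?_)
open import Data.Integer as ℤ using (ℤ; +_)
open import Data.Fin using (Fin; toℕ)
open import Data.Fin.Properties using () renaming (_≟_ to _≟ᶠ_)
open import Data.Bool using (Bool; true; false; _∧_; not; if_then_else_)
open import Data.List using (List; []; _∷_; length; map; concatMap; foldr; filterᵇ; allFin; upTo)
open import Data.Nat.ListAction using (sum)
open import Data.Bool.ListAction using (all; any)
open import Data.Product using (_×_; _,_; proj₁; proj₂)
open import Data.List.Relation.Unary.Unique.Propositional using (Unique)
open import Data.List.Relation.Unary.All using (All)
open import Data.Vec using (Vec; []; _∷_; lookup)
open import Relation.Binary.PropositionalEquality using (_≡_)
open import Relation.Nullary.Decidable using (⌊_⌋)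

record SimpleGraph (n : ℕ) : Set where
  field
    adj    : Fin n → Fin n → Bool
    sym    : ∀ i j → adj i j ≡ adj j i
    irrefl : ∀ i → adj i i ≡ false
open SimpleGraph public

edgeCount : ∀ {n} → SimpleGraph n → ℕ
edgeCount {n} G =
  length (filterᵇ (λ ij → ⌊ suc (toℕ (proj₁ ij)) ≤? toℕ (proj₂ ij) ⌋ ∧ adj G (proj₁ ij) (proj₂ ij))
    (concatMap (λ i → map (λ j → (i , j)) (allFin n)) (allFin n)))

-- A restraint assigns to each vertex a finite list of forbidden colours.
-- It represents a finite set: the list must be duplicate-free (Unique),
-- and colours are positive natural numbers (colours are 1,2,3,...).
Restraint : ℕ → Set
Restraint n = Fin n → List ℕ

ValidRestraint : ∀ {n} → Restraint n → Set
ValidRestraint {n} r = ∀ v → Unique (r v) × All (1 ≤_) (r v)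

maxRestraint : ∀ {n} → Restraint n → ℕ
maxRestraint {n} r = foldr (λ v acc → foldr _⊔_ 0 (r v) ⊔ acc) 0 (allFin n)

restraintSize : ∀ {n} → Restraint n → ℕ
restraintSize {n} r = sum (map (λ v → length (r v)) (allFin n))

allColourings : (n x : ℕ) → List (Vec (Fin x) n)
allColourings zero    x = [] ∷ []
allColourings (suc n) x = concatMap (λ c → map (c ∷_) (allColourings n x)) (allFin x)

colourOf : ∀ {n x} → Vec (Fin x) n → Fin n → ℕ
colourOf c v = suc (toℕ (lookup c v))

isProper : ∀ {n x} → SimpleGraph n → Vec (Fin x) n → Bool
isProper {n} G c =
  all (λ i → all (λ j → not (adj G i j ∧ ⌊ lookup c i ≟ᶠ lookup c j ⌋)) (allFin n)) (allFin n)

isPermitted : ∀ {n x} → Restraint n → Vec (Fin x) n → Bool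
isPermitted {n} r c = all (λ v → not (any (λ k → ⌊ k ≟ colourOf c v ⌋) (r v))) (allFin n)

restrainedChromatic : ∀ {n} → SimpleGraph n → Restraint n → ℕ → ℕ
restrainedChromatic G r x =
  length (filterᵇ (λ c → isProper G c ∧ isPermitted r c) (allColourings _ x))

signedPoly : ℕ → (ℕ → ℤ) → ℤ → ℤ
signedPoly n a x =
  foldr ℤ._+_ (+ 0) (map (λ i → (ℤ.- (+ 1)) ℤ.^ (n ∸ i) ℤ.* a i ℤ.* x ℤ.^ i) (upTo (suc n)))

module Submission where

-- Colour vertex 0 first.  Each of the x − |r(0)| colours c allowed there leaves the colourings of G − 0
-- under the restraint r_c that also forbids c at the neighbours of 0, so π_r(G, x) = Σ_c π_{r_c}(G − 0, x).
-- With N = m_G + Σ_u |r(u)|, the pair (G − 0, r_c) carries N − |r(0)| − t_c constraints, where t_c counts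
-- the neighbours of 0 that already forbid c; and Σ_c t_c ≤ Σ_{u ≠ 0} |r(u)|.  Induction on n then gives
--   x^n − N x^(n−1) ≤ π_r(G, x) ≤ x^n − N x^(n−1) + K x^(n−2)   for x ≥ M_{G,r},
-- with K depending only on n and N, and a polynomial squeezed this way has coefficients 1 and −N in
-- degrees n and n − 1.

open import Defs hiding (sym)

module Polynomials where

  open import Data.Nat as ℕ using (ℕ; zero; suc; _∸_; _⊔_; s≤s)
  import Data.Nat.Properties as ℕ
  import Data.Nat.Tactic.RingSolver as NatSolver
  open import Data.Integer using (ℤ; +_; 0ℤ; 1ℤ; _+_; _*_; -_; _-_; _^_; ∣_∣; _⊖_)
  open import Data.Integer.Properties
    using ( pos-*; abs-*; m-n≡m⊖n; ⊖-≥; ∣i+j∣≤∣i∣+∣j∣; ∣i-j∣≤∣i∣+∣j∣; ∣i∣≡0⇒i≡0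
          ; +-identityˡ; +-identityʳ; +-assoc; neg-involutive)
  open import Data.Integer.Tactic.RingSolver using (solve-∀)
  open import Data.List using ([]; _∷_; _∷ʳ_; foldr; applyUpTo)
  open import Data.List.Properties using (map-upTo; applyUpTo-∷ʳ; foldr-∷ʳ)
  open import Relation.Binary.PropositionalEquality

  pos-^ : ∀ x k → + (x ℕ.^ k) ≡ (+ x) ^ k
  pos-^ x zero    = refl
  pos-^ x (suc k) = trans (pos-* x (x ℕ.^ k)) (cong (+ x *_) (pos-^ x k))

  poly : ℕ → (ℕ → ℤ) → ℤ → ℤ
  poly zero    c X = 0ℤ
  poly (suc d) c X = poly d c X + c d * X ^ d

  foldr-+-init : ∀ z xs → foldr _+_ z xs ≡ foldr _+_ 0ℤ xs + z
  foldr-+-init z []       = sym (+-identityˡ z)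
  foldr-+-init z (x ∷ xs) = trans (cong (λ s → x + s) (foldr-+-init z xs)) (sym (+-assoc x _ z))

  foldr-applyUpTo : ∀ c X k → foldr _+_ 0ℤ (applyUpTo (λ i → c i * X ^ i) k) ≡ poly k c X
  foldr-applyUpTo c X zero    = refl
  foldr-applyUpTo c X (suc k) = begin
    foldr _+_ 0ℤ (applyUpTo f (suc k))       ≡⟨ cong (foldr _+_ 0ℤ) (sym (applyUpTo-∷ʳ f k)) ⟩
    foldr _+_ 0ℤ (applyUpTo f k ∷ʳ f k) ≡⟨ foldr-∷ʳ _+_ 0ℤ (f k) (applyUpTo f k) ⟩
    foldr _+_ (f k + 0ℤ) (applyUpTo f k)     ≡⟨ foldr-+-init _ (applyUpTo f k) ⟩
    foldr _+_ 0ℤ (applyUpTo f k) + (f k + 0ℤ) ≡⟨ cong₂ _+_ (foldr-applyUpTo c X k) (+-identityʳ (f k)) ⟩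
    poly (suc k) c X                         ∎
    where
      open ≡-Reasoning
      f : ℕ → ℤ
      f i = c i * X ^ i

  signedPoly≡poly : ∀ n a X → signedPoly n a X ≡ poly (suc n) (λ i → (- + 1) ^ (n ∸ i) * a i) X
  signedPoly≡poly n a X =
    trans (cong (foldr _+_ 0ℤ) (map-upTo (λ i → (- + 1) ^ (n ∸ i) * a i * X ^ i) (suc n))) (foldr-applyUpTo _ X (suc n))

  -- f x = O(x^(d − 1)), multiplied through by x so that d = 0 (f eventually zero) needs no special case.
  record DegreeBelow (d : ℕ) (f : ℕ → ℤ) : Set where
    constructor bounded
    field
      constant threshold : ℕ
      bound : ∀ x → threshold ℕ.≤ x → x ℕ.* ∣ f x ∣ ℕ.≤ constant ℕ.* x ℕ.^ d

  ∣monomial∣ : ∀ t x d → ∣ t * (+ x) ^ d ∣ ≡ ∣ t ∣ ℕ.* x ℕ.^ d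
  ∣monomial∣ t x d = trans (abs-* t _) (cong (λ i → ∣ t ∣ ℕ.* ∣ i ∣) (sym (pos-^ x d)))

  degreeBelow-congᵉ : ∀ {d f g} M → (∀ x → M ℕ.≤ x → f x ≡ g x) → DegreeBelow d f → DegreeBelow d g
  degreeBelow-congᵉ M f≡g (bounded K M₀ bound) = bounded K (M ⊔ M₀) λ x le →
    subst (λ y → x ℕ.* ∣ y ∣ ℕ.≤ _) (f≡g x (ℕ.m⊔n≤o⇒m≤o M M₀ le)) (bound x (ℕ.m⊔n≤o⇒n≤o M M₀ le))

  degreeBelow-suc : ∀ {d f} → DegreeBelow d f → DegreeBelow (suc d) f
  degreeBelow-suc {d} (bounded K M bound) = bounded K (suc M) λ where
    x@(suc _) (s≤s le) → ℕ.≤-trans (bound x (ℕ.m≤n⇒m≤1+n le)) (ℕ.*-monoʳ-≤ K (ℕ.m≤n*m (x ℕ.^ d) x))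

  degreeBelow-+-monomial : ∀ {d f} t → DegreeBelow d f → DegreeBelow (suc d) (λ x → f x + t * (+ x) ^ d)
  degreeBelow-+-monomial {d} {f} t degree with degreeBelow-suc {d} {f} degree
  ... | bounded K M bound = bounded (K ℕ.+ ∣ t ∣) M λ x le → begin
    x ℕ.* ∣ f x + t * (+ x) ^ d ∣                   ≤⟨ ℕ.*-monoʳ-≤ x (∣i+j∣≤∣i∣+∣j∣ (f x) _) ⟩
    x ℕ.* (∣ f x ∣ ℕ.+ ∣ t * (+ x) ^ d ∣)           ≡⟨ cong (λ m → x ℕ.* (∣ f x ∣ ℕ.+ m)) (∣monomial∣ t x d) ⟩
    x ℕ.* (∣ f x ∣ ℕ.+ ∣ t ∣ ℕ.* x ℕ.^ d)           ≡⟨ distribute x ∣ f x ∣ ∣ t ∣ (x ℕ.^ d) ⟩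
    x ℕ.* ∣ f x ∣ ℕ.+ ∣ t ∣ ℕ.* x ℕ.^ suc d         ≤⟨ ℕ.+-monoˡ-≤ _ (bound x le) ⟩
    K ℕ.* x ℕ.^ suc d ℕ.+ ∣ t ∣ ℕ.* x ℕ.^ suc d     ≡⟨ ℕ.*-distribʳ-+ (x ℕ.^ suc d) K ∣ t ∣ ⟨
    (K ℕ.+ ∣ t ∣) ℕ.* x ℕ.^ suc d                   ∎
    where
      open ℕ.≤-Reasoning
      distribute : ∀ x a b y → x ℕ.* (a ℕ.+ b ℕ.* y) ≡ x ℕ.* a ℕ.+ b ℕ.* (x ℕ.* y)
      distribute = NatSolver.solve-∀

  poly-degreeBelow : ∀ d c → DegreeBelow d (λ x → poly d c (+ x))
  poly-degreeBelow zero    c = bounded 0 0 λ x _ → ℕ.≤-reflexive (ℕ.*-zeroʳ x)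
  poly-degreeBelow (suc d) c = degreeBelow-+-monomial (c d) (poly-degreeBelow d c)

  coefficient-zero : ∀ {d f g} t → DegreeBelow d f → DegreeBelow d g →
                     (∀ x → g x ≡ f x + t * (+ x) ^ d) → t ≡ 0ℤ
  coefficient-zero {d} {f} {g} t (bounded K₁ M₁ bound₁) (bounded K₂ M₂ bound₂) g≡f+t =
    ∣i∣≡0⇒i≡0 (ℕ.n<1⇒n≡0 (ℕ.*-cancelˡ-< x ∣ t ∣ 1 (ℕ.≤-<-trans x∣t∣≤K (subst (K ℕ.<_) (sym (ℕ.*-identityʳ x)) K<x))))
    where
      K x : ℕ
      K = K₁ ℕ.+ K₂
      x = suc (K ℕ.+ (M₁ ℕ.+ M₂))
      K<x : K ℕ.< x
      K<x = s≤s (ℕ.m≤m+n K _)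
      M₁≤x : M₁ ℕ.≤ x
      M₁≤x = ℕ.m≤n⇒m≤1+n (ℕ.≤-trans (ℕ.m≤m+n M₁ M₂) (ℕ.m≤n+m _ K))
      M₂≤x : M₂ ℕ.≤ x
      M₂≤x = ℕ.m≤n⇒m≤1+n (ℕ.≤-trans (ℕ.m≤n+m M₂ M₁) (ℕ.m≤n+m _ K))
      x∣t∣x^d≤Kx^d : x ℕ.* ∣ t ∣ ℕ.* x ℕ.^ d ℕ.≤ K ℕ.* x ℕ.^ d
      x∣t∣x^d≤Kx^d = begin
        x ℕ.* ∣ t ∣ ℕ.* x ℕ.^ d             ≡⟨ ℕ.*-assoc x ∣ t ∣ _ ⟩
        x ℕ.* (∣ t ∣ ℕ.* x ℕ.^ d)           ≡⟨ cong (x ℕ.*_) (∣monomial∣ t x d) ⟨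
        x ℕ.* ∣ t * (+ x) ^ d ∣             ≡⟨ cong (λ i → x ℕ.* ∣ i ∣) (cancel (g x) (f x) _ (g≡f+t x)) ⟨
        x ℕ.* ∣ g x - f x ∣                 ≤⟨ ℕ.*-monoʳ-≤ x (∣i-j∣≤∣i∣+∣j∣ (g x) (f x)) ⟩
        x ℕ.* (∣ g x ∣ ℕ.+ ∣ f x ∣)         ≡⟨ ℕ.*-distribˡ-+ x ∣ g x ∣ _ ⟩
        x ℕ.* ∣ g x ∣ ℕ.+ x ℕ.* ∣ f x ∣     ≤⟨ ℕ.+-mono-≤ (bound₂ x M₂≤x) (bound₁ x M₁≤x) ⟩
        K₂ ℕ.* x ℕ.^ d ℕ.+ K₁ ℕ.* x ℕ.^ d   ≡⟨ ℕ.*-distribʳ-+ (x ℕ.^ d) K₂ K₁ ⟨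
        (K₂ ℕ.+ K₁) ℕ.* x ℕ.^ d             ≡⟨ cong (ℕ._* x ℕ.^ d) (ℕ.+-comm K₂ K₁) ⟩
        K ℕ.* x ℕ.^ d                       ∎
        where
          open ℕ.≤-Reasoning
          cancel : ∀ a b c → a ≡ b + c → a - b ≡ c
          cancel a b c refl = sub-add b c
            where sub-add : ∀ b c → b + c - b ≡ c
                  sub-add = solve-∀
      x∣t∣≤K : x ℕ.* ∣ t ∣ ℕ.≤ K
      x∣t∣≤K = ℕ.*-cancelʳ-≤ _ _ (x ℕ.^ d) {{ℕ.m^n≢0 x d}} x∣t∣x^d≤Kx^d

  subleading-coefficient : ∀ m c N →
    DegreeBelow m (λ x → poly (2 ℕ.+ m) c (+ x) - (+ x) ^ suc m + + N * (+ x) ^ m) → c m ≡ - + N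
  subleading-coefficient m c N degree = isolate (coefficient-zero (c m + + N) (poly-degreeBelow m c) degree without-leading)
    where
      leading-split : ∀ p a b n X Y → p + a * Y + b * (X * Y) - X * Y + n * Y ≡ (p + (a + n) * Y) + (b - 1ℤ) * (X * Y)
      leading-split = solve-∀
      leading : c (suc m) - 1ℤ ≡ 0ℤ
      leading = coefficient-zero (c (suc m) - 1ℤ) (degreeBelow-+-monomial (c m + + N) (poly-degreeBelow m c))
        (degreeBelow-suc degree) (λ x → leading-split (poly m c (+ x)) (c m) (c (suc m)) (+ N) (+ x) ((+ x) ^ m))
      drop-zero : ∀ p b Z → b ≡ 0ℤ → p + b * Z ≡ p
      drop-zero p .0ℤ Z refl = +-identityʳ p
      without-leading : ∀ x → poly (2 ℕ.+ m) c (+ x) - (+ x) ^ suc m + + N * (+ x) ^ m ≡ poly m c (+ x) + (c m + + N) * (+ x) ^ m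
      without-leading x = trans (leading-split (poly m c (+ x)) (c m) (c (suc m)) (+ N) (+ x) ((+ x) ^ m)) (drop-zero _ _ _ leading)
      isolate : c m + + N ≡ 0ℤ → c m ≡ - + N
      isolate eq = trans (move (c m) (+ N)) (trans (cong (_- + N) eq) (+-identityˡ (- + N)))
        where move : ∀ a n → a ≡ a + n - n
              move = solve-∀

  signedPoly-subleading : ∀ m a N →
    DegreeBelow m (λ x → signedPoly (suc m) a (+ x) - (+ x) ^ suc m + + N * (+ x) ^ m) → a m ≡ + N
  signedPoly-subleading m a N degree = negate (subst (λ k → (- + 1) ^ k * a m ≡ - + N) (ℕ.m+n∸n≡m 1 m) cₘ≡-N)
    where
      cₘ≡-N : (- + 1) ^ (suc m ∸ m) * a m ≡ - + N
      cₘ≡-N = subleading-coefficient m _ N (degreeBelow-congᵉ 0 (λ x _ → cong (λ p → p - (+ x) ^ suc m + + N * (+ x) ^ m)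
                                                                           (signedPoly≡poly (suc m) a (+ x))) degree)
      negate : (- + 1) ^ 1 * a m ≡ - + N → a m ≡ + N
      negate eq = trans (flip (a m)) (trans (cong -_ eq) (neg-involutive (+ N)))
        where flip : ∀ a → a ≡ - ((- + 1) ^ 1 * a)
              flip = solve-∀

  degreeBelow-sandwich : ∀ {d} {f : ℕ → ℤ} (A B : ℕ → ℕ) K M →
    (∀ x → M ℕ.≤ x → B x ℕ.≤ A x) → (∀ x → M ℕ.≤ x → A x ℕ.≤ B x ℕ.+ K ℕ.* x ℕ.^ suc d) →
    (∀ x → + A x - + B x ≡ + x * (+ x * f x)) → DegreeBelow d f
  degreeBelow-sandwich {d} {f} A B K M B≤A A≤B+K eq =
    bounded K (suc M) λ { x@(suc _) (s≤s M≤x) → ℕ.*-cancelˡ-≤ x (x²∣f∣≤ x (ℕ.m≤n⇒m≤1+n M≤x)) }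
    where
      open ℕ.≤-Reasoning
      x²∣f∣≤ : ∀ x → M ℕ.≤ x → x ℕ.* (x ℕ.* ∣ f x ∣) ℕ.≤ x ℕ.* (K ℕ.* x ℕ.^ d)
      x²∣f∣≤ x M≤x = begin
        x ℕ.* (x ℕ.* ∣ f x ∣)       ≡⟨ cong (x ℕ.*_) (abs-* (+ x) (f x)) ⟨
        x ℕ.* ∣ + x * f x ∣         ≡⟨ abs-* (+ x) (+ x * f x) ⟨
        ∣ + x * (+ x * f x) ∣       ≡⟨ cong ∣_∣ (trans (sym (eq x)) (m-n≡m⊖n (A x) (B x))) ⟩
        ∣ A x ⊖ B x ∣               ≡⟨ cong ∣_∣ (⊖-≥ (B≤A x M≤x)) ⟩
        A x ∸ B x                   ≤⟨ ℕ.m≤n+o⇒m∸n≤o (A x) (B x) (A≤B+K x M≤x) ⟩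
        K ℕ.* (x ℕ.* x ℕ.^ d)       ≡⟨ swap K x (x ℕ.^ d) ⟩
        x ℕ.* (K ℕ.* x ℕ.^ d)       ∎
        where swap : ∀ k x y → k ℕ.* (x ℕ.* y) ≡ x ℕ.* (k ℕ.* y)
              swap = NatSolver.solve-∀

module Chromatic where

  open import Data.Bool using (Bool; true; false; T; not; _∧_; if_then_else_)
  open import Data.Bool.Properties using (T-∧)
  open import Data.Bool.ListAction using (all; any)
  open import Data.Empty using (⊥-elim)
  open import Data.Fin using (Fin; zero; suc; toℕ; fromℕ<)
  open import Data.Fin.Properties using (toℕ<n; toℕ-injective; toℕ-fromℕ<) renaming (_≟_ to _≟ᶠ_)
  open import Data.List using (List; []; _∷_; _++_; allFin; length; map; filterᵇ; concatMap; foldr)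
  open import Data.List.Properties using (map-tabulate; filter-++; length-++; length-map; length-tabulate)
  open import Data.List.Membership.Propositional using (_∈_; _∉_)
  open import Data.List.Membership.Propositional.Properties using (∈-allFin; ∈-map⁺; ∈-map⁻; ∈-filter⁺; ∈-filter⁻)
  open import Data.List.Membership.Propositional.Properties.WithK using (unique∧set⇒bag)
  open import Data.List.Relation.Binary.BagAndSetEquality using (∼bag⇒↭)
  open import Data.List.Relation.Binary.Permutation.Propositional.Properties using (↭-length)
  open import Data.List.Relation.Unary.All as All using (All; _∷_)
  open import Data.List.Relation.Unary.All.Properties using (all⁺; all⁻; ¬Any⇒All¬)
  open import Data.List.Relation.Unary.Any as Any using (here; there)
  open import Data.List.Relation.Unary.Any.Properties using (any⁺; any⁻)
  open import Data.List.Relation.Unary.AllPairs using (_∷_)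
  open import Data.List.Relation.Unary.Unique.Propositional using (Unique)
  open import Data.List.Relation.Unary.Unique.Propositional.Properties using (map⁺; filter⁺; allFin⁺)
  open import Data.Nat using (ℕ; zero; suc; _+_; _*_; _^_; _≤_; _≟_; _≤?_; _⊔_; z≤n; s≤s; s≤s⁻¹)
  open import Data.Nat.ListAction using (sum)
  open import Data.Nat.Properties
  open import Data.Nat.Tactic.RingSolver using (solve-∀)
  open import Data.List.Membership.DecPropositional _≟_ using (_∈?_)
  open import Data.Product using (_×_; _,_; proj₁; proj₂)
  open import Data.Sum using (_⊎_; inj₁; inj₂)
  open import Data.Unit using (tt)
  open import Data.Vec using (Vec; _∷_; lookup)
  open import Function using (_∘_; _⇔_; mk⇔; Equivalence)
  open import Relation.Binary.PropositionalEquality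
  open import Relation.Nullary using (¬_; yes; no)
  open import Relation.Nullary.Decidable using (⌊_⌋; toWitness; fromWitness; T?; does-⇔; isYes≗does)

  private
    variable
      A B : Set
      n x : ℕ

  ∑ : List A → (A → ℕ) → ℕ
  ∑ xs f = sum (map f xs)

  𝟙 : Bool → ℕ
  𝟙 true  = 1
  𝟙 false = 0

  ∑-cong : ∀ xs {f g : A → ℕ} → (∀ a → f a ≡ g a) → ∑ xs f ≡ ∑ xs g
  ∑-cong []       eq = refl
  ∑-cong (a ∷ xs) eq = cong₂ _+_ (eq a) (∑-cong xs eq)

  ∑-mono-≤ : ∀ xs {f g : A → ℕ} → (∀ {a} → a ∈ xs → f a ≤ g a) → ∑ xs f ≤ ∑ xs g
  ∑-mono-≤ []       le = z≤n
  ∑-mono-≤ (a ∷ xs) le = +-mono-≤ (le (here refl)) (∑-mono-≤ xs (le ∘ there))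

  ∑-+ : ∀ xs (f g : A → ℕ) → ∑ xs (λ a → f a + g a) ≡ ∑ xs f + ∑ xs g
  ∑-+ []       f g = refl
  ∑-+ (a ∷ xs) f g = trans (cong (f a + g a +_) (∑-+ xs f g)) (shuffle (f a) (g a) _ _)
    where shuffle : ∀ p q r s → p + q + (r + s) ≡ p + r + (q + s)
          shuffle = solve-∀

  ∑-*ˡ : ∀ xs k (f : A → ℕ) → ∑ xs (λ a → k * f a) ≡ k * ∑ xs f
  ∑-*ˡ []       k f = sym (*-zeroʳ k)
  ∑-*ˡ (a ∷ xs) k f = trans (cong (k * f a +_) (∑-*ˡ xs k f)) (sym (*-distribˡ-+ k (f a) _))

  ∑-*ʳ : ∀ xs k (f : A → ℕ) → ∑ xs (λ a → f a * k) ≡ ∑ xs f * k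
  ∑-*ʳ xs k f = trans (∑-cong xs (λ a → *-comm (f a) k)) (trans (∑-*ˡ xs k f) (*-comm k _))

  ∑-const : ∀ (xs : List A) k → ∑ xs (λ _ → k) ≡ length xs * k
  ∑-const []       k = refl
  ∑-const (a ∷ xs) k = cong (k +_) (∑-const xs k)

  ∑-swap : ∀ (xs : List A) (ys : List B) (f : A → B → ℕ) → ∑ xs (λ a → ∑ ys (f a)) ≡ ∑ ys (λ b → ∑ xs (λ a → f a b))
  ∑-swap []       ys f = sym (trans (∑-const ys 0) (*-zeroʳ (length ys)))
  ∑-swap (a ∷ xs) ys f = trans (cong (∑ ys (f a) +_) (∑-swap xs ys f)) (sym (∑-+ ys (f a) _))

  ∑-allFin-suc : ∀ n (f : Fin (suc n) → ℕ) → ∑ (allFin (suc n)) f ≡ f zero + ∑ (allFin n) (f ∘ suc)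
  ∑-allFin-suc n f = cong (λ xs → f zero + sum xs) (trans (map-tabulate suc f) (sym (map-tabulate (λ i → i) (f ∘ suc))))

  ∑-filterᵇ : ∀ (p : A → Bool) xs f → ∑ (filterᵇ p xs) f ≡ ∑ xs (λ a → 𝟙 (p a) * f a)
  ∑-filterᵇ p []       f = refl
  ∑-filterᵇ p (a ∷ xs) f with p a
  ... | true  = cong₂ _+_ (sym (+-identityʳ (f a))) (∑-filterᵇ p xs f)
  ... | false = ∑-filterᵇ p xs f

  length-filterᵇ : ∀ (p : A → Bool) xs → length (filterᵇ p xs) ≡ ∑ xs (𝟙 ∘ p)
  length-filterᵇ p []       = refl
  length-filterᵇ p (a ∷ xs) with p a
  ... | true  = cong suc (length-filterᵇ p xs)
  ... | false = length-filterᵇ p xs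

  length-filterᵇ-map : ∀ (p : B → Bool) (g : A → B) xs → length (filterᵇ p (map g xs)) ≡ length (filterᵇ (p ∘ g) xs)
  length-filterᵇ-map p g []       = refl
  length-filterᵇ-map p g (a ∷ xs) with p (g a)
  ... | true  = cong suc (length-filterᵇ-map p g xs)
  ... | false = length-filterᵇ-map p g xs

  length-filterᵇ-concatMap : ∀ (p : B → Bool) (g : A → List B) xs →
    length (filterᵇ p (concatMap g xs)) ≡ ∑ xs (λ a → length (filterᵇ p (g a)))
  length-filterᵇ-concatMap p g []       = refl
  length-filterᵇ-concatMap p g (a ∷ xs) = begin
    length (filterᵇ p (g a ++ concatMap g xs))                   ≡⟨ cong length (filter-++ (T? ∘ p) (g a) _) ⟩
    length (filterᵇ p (g a) ++ filterᵇ p (concatMap g xs))       ≡⟨ length-++ (filterᵇ p (g a)) ⟩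
    length (filterᵇ p (g a)) + length (filterᵇ p (concatMap g xs)) ≡⟨ cong (_ +_) (length-filterᵇ-concatMap p g xs) ⟩
    ∑ (a ∷ xs) (λ a → length (filterᵇ p (g a)))                  ∎
    where open ≡-Reasoning

  length-filterᵇ-not : ∀ (p : A → Bool) xs → length (filterᵇ p xs) + length (filterᵇ (not ∘ p) xs) ≡ length xs
  length-filterᵇ-not p []       = refl
  length-filterᵇ-not p (a ∷ xs) with p a
  ... | true  = cong suc (length-filterᵇ-not p xs)
  ... | false = trans (+-suc _ _) (cong suc (length-filterᵇ-not p xs))

  length-filterᵇ-cong : ∀ {p q : A → Bool} xs → (∀ a → p a ≡ q a) → length (filterᵇ p xs) ≡ length (filterᵇ q xs)
  length-filterᵇ-cong {p = p} {q} xs p≡q = trans (length-filterᵇ p xs) (trans (∑-cong xs (cong 𝟙 ∘ p≡q)) (sym (length-filterᵇ q xs)))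

  length-filterᵇ-∧ : ∀ b (q : A → Bool) xs → length (filterᵇ (λ a → b ∧ q a) xs) ≡ 𝟙 b * length (filterᵇ q xs)
  length-filterᵇ-∧ true  q xs = sym (+-identityʳ _)
  length-filterᵇ-∧ false q xs = trans (length-filterᵇ _ xs) (trans (∑-const xs 0) (*-zeroʳ (length xs)))

  ∑-filterᵇ-≤ : ∀ (p : A → Bool) xs f → ∑ (filterᵇ p xs) f ≤ ∑ xs f
  ∑-filterᵇ-≤ p xs f = ≤-trans (≤-reflexive (∑-filterᵇ p xs f)) (∑-mono-≤ xs (λ {a} _ → 𝟙*≤ (p a) (f a)))
    where 𝟙*≤ : ∀ b m → 𝟙 b * m ≤ m
          𝟙*≤ true  m = ≤-reflexive (+-identityʳ m)
          𝟙*≤ false m = z≤n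

  𝟙-∧-≤ʳ : ∀ a b → 𝟙 (a ∧ b) ≤ 𝟙 b
  𝟙-∧-≤ʳ true  b = ≤-refl
  𝟙-∧-≤ʳ false b = z≤n

  ∑-linear : ∀ xs k m (f g : A → ℕ) → ∑ xs (λ a → k * f a + g a * m) ≡ k * ∑ xs f + ∑ xs g * m
  ∑-linear xs k m f g = trans (∑-+ xs _ _) (cong₂ _+_ (∑-*ˡ xs k f) (∑-*ʳ xs m g))

  colour : Fin x → ℕ
  colour c = suc (toℕ c)

  colour-injective : ∀ {c c′ : Fin x} → colour c ≡ colour c′ → c ≡ c′
  colour-injective = toℕ-injective ∘ suc-injective

  Proper : SimpleGraph n → Vec (Fin x) n → Set
  Proper G cs = ∀ i j → T (adj G i j) → lookup cs i ≢ lookup cs j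

  Permitted : Restraint n → Vec (Fin x) n → Set
  Permitted r cs = ∀ v → colour (lookup cs v) ∉ r v

  T-not : ∀ {b} → T (not b) ⇔ (¬ T b)
  T-not {true}  = mk⇔ (λ ()) (λ f → f tt)
  T-not {false} = mk⇔ (λ _ ()) (λ _ → tt)

  T-all-allFin : (p : Fin n → Bool) → T (all p (allFin n)) ⇔ (∀ i → T (p i))
  T-all-allFin p = mk⇔ (λ t i → All.lookup (all⁺ p (allFin _) t) (∈-allFin i)) (λ h → all⁻ p {xs = allFin _} (All.tabulate (λ {i} _ → h i)))

  T-any-≟ : ∀ k ks → T (any (λ j → ⌊ j ≟ k ⌋) ks) ⇔ k ∈ ks
  T-any-≟ k ks = mk⇔ (Any.map (sym ∘ toWitness) ∘ any⁻ _ ks) (any⁺ _ ∘ Any.map (fromWitness ∘ sym))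

  isProper⇔Proper : (G : SimpleGraph n) (cs : Vec (Fin x) n) → T (isProper G cs) ⇔ Proper G cs
  isProper⇔Proper {n} G cs = mk⇔
    (λ t i j a e → T-not .to (T-all-allFin (no-clash i) .to (T-all-allFin _ .to t i) j) (T-∧ {adj G i j} .from (a , fromWitness e)))
    (λ h → T-all-allFin _ .from λ i → T-all-allFin (no-clash i) .from λ j →
             T-not .from λ t → h i j (proj₁ (T-∧ {adj G i j} .to t)) (toWitness (proj₂ (T-∧ {adj G i j} .to t))))
    where
      open Equivalence
      no-clash : Fin n → Fin n → Bool
      no-clash i j = not (adj G i j ∧ ⌊ lookup cs i ≟ᶠ lookup cs j ⌋)

  isPermitted⇔Permitted : (r : Restraint n) (cs : Vec (Fin x) n) → T (isPermitted r cs) ⇔ Permitted r cs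
  isPermitted⇔Permitted {n} r cs = mk⇔
    (λ t v → T-not .to (T-all-allFin avoids .to t v) ∘ T-any-≟ _ (r v) .from)
    (λ h → T-all-allFin avoids .from λ v → T-not .from (h v ∘ T-any-≟ _ (r v) .to))
    where
      open Equivalence
      avoids : Fin n → Bool
      avoids v = not (any (λ k → ⌊ k ≟ colourOf cs v ⌋) (r v))

  admissible : SimpleGraph n → Restraint n → Vec (Fin x) n → Bool
  admissible G r cs = isProper G cs ∧ isPermitted r cs

  T-admissible : (G : SimpleGraph n) (r : Restraint n) (cs : Vec (Fin x) n) → T (admissible G r cs) ⇔ (Proper G cs × Permitted r cs)
  T-admissible G r cs = mk⇔
    (λ t → isProper⇔Proper G cs .to (proj₁ (T-∧ .to t)) , isPermitted⇔Permitted r cs .to (proj₂ (T-∧ {isProper G cs} .to t)))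
    (λ (proper , permitted) → T-∧ .from (isProper⇔Proper G cs .from proper , isPermitted⇔Permitted r cs .from permitted))
    where open Equivalence

  insert : ℕ → List ℕ → List ℕ
  insert k ks = if ⌊ k ∈? ks ⌋ then ks else k ∷ ks

  module _ {k : ℕ} {ks : List ℕ} where

    ∈-insert : k ∈ insert k ks
    ∈-insert with k ∈? ks
    ... | yes k∈ks = k∈ks
    ... | no  _    = here refl

    ∈-insert⁺ : ∀ {j} → j ∈ ks → j ∈ insert k ks
    ∈-insert⁺ j∈ks with k ∈? ks
    ... | yes _ = j∈ks
    ... | no  _ = there j∈ks

    ∈-insert⁻ : ∀ {j} → j ∈ insert k ks → j ≡ k ⊎ j ∈ ks
    ∈-insert⁻ j∈ with k ∈? ks
    ∈-insert⁻ j∈           | yes _ = inj₂ j∈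
    ∈-insert⁻ (here j≡k)   | no  _ = inj₁ j≡k
    ∈-insert⁻ (there j∈ks) | no  _ = inj₂ j∈ks

    insert-unique : Unique ks → Unique (insert k ks)
    insert-unique unique with k ∈? ks
    ... | yes _   = unique
    ... | no  k∉ks = ¬Any⇒All¬ ks k∉ks ∷ unique

    All-insert : ∀ {P : ℕ → Set} → P k → All P ks → All P (insert k ks)
    All-insert pk pks with k ∈? ks
    ... | yes _ = pks
    ... | no  _ = pk ∷ pks

    length-insert : length (insert k ks) + 𝟙 ⌊ k ∈? ks ⌋ ≡ length ks + 1
    length-insert with k ∈? ks
    ... | yes _ = refl
    ... | no  _ = trans (+-identityʳ _) (+-comm 1 (length ks))

  Bounded : ℕ → Restraint n → Set
  Bounded x r = ∀ v → All (_≤ x) (r v)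

  foldr-⊔-upper : ∀ (f : A → ℕ) xs {a} → a ∈ xs → f a ≤ foldr (λ b m → f b ⊔ m) 0 xs
  foldr-⊔-upper f (b ∷ xs) (here refl) = m≤m⊔n (f b) _
  foldr-⊔-upper f (b ∷ xs) (there a∈) = ≤-trans (foldr-⊔-upper f xs a∈) (m≤n⊔m (f b) _)

  maxRestraint-bounded : (r : Restraint n) → maxRestraint r ≤ x → Bounded x r
  maxRestraint-bounded {n} r max≤x v = All.tabulate λ k∈ →
    ≤-trans (foldr-⊔-upper (λ k → k) (r v) k∈) (≤-trans (foldr-⊔-upper (λ u → foldr _⊔_ 0 (r u)) (allFin n) (∈-allFin v)) max≤x)

  forbidden : List ℕ → Fin x → Bool
  forbidden ks c = ⌊ colour c ∈? ks ⌋

  -- map colour hits and ks are duplicate-free lists with the same elements, hence permutations of each other.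
  length-forbidden : ∀ x ks → Unique ks → All (1 ≤_) ks → All (_≤ x) ks → length (filterᵇ (forbidden ks) (allFin x)) ≡ length ks
  length-forbidden x ks unique positive bounded = begin
    length hits              ≡⟨ length-map colour hits ⟨
    length (map colour hits) ≡⟨ ↭-length (∼bag⇒↭ (unique∧set⇒bag hits-unique unique (mk⇔ sound complete))) ⟩
    length ks                ∎
    where
      open ≡-Reasoning
      hits : List (Fin x)
      hits = filterᵇ (forbidden ks) (allFin x)
      hits-unique : Unique (map colour hits)
      hits-unique = map⁺ colour-injective (filter⁺ (T? ∘ forbidden ks) (allFin⁺ x))
      sound : ∀ {k} → k ∈ map colour hits → k ∈ ks
      sound k∈ with ∈-map⁻ colour k∈
      ... | c , c∈hits , refl = toWitness (proj₂ (∈-filter⁻ (T? ∘ forbidden ks) {xs = allFin x} c∈hits))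
      complete : ∀ {k} → k ∈ ks → k ∈ map colour hits
      complete k∈ with All.lookup positive k∈ | All.lookup bounded k∈
      complete {suc k} k∈ | s≤s _ | k<x =
        subst (_∈ map colour hits) (cong suc (toℕ-fromℕ< k<x))
          (∈-map⁺ colour (∈-filter⁺ (T? ∘ forbidden ks) (∈-allFin (fromℕ< k<x))
            (fromWitness (subst (_∈ ks) (cong suc (sym (toℕ-fromℕ< k<x))) k∈))))

  allowed : ∀ x → List ℕ → List (Fin x)
  allowed x ks = filterᵇ (not ∘ forbidden ks) (allFin x)

  length-allowed : ∀ x ks → Unique ks → All (1 ≤_) ks → All (_≤ x) ks → length (allowed x ks) + length ks ≡ x
  length-allowed x ks unique positive bounded = begin
    length (allowed x ks) + length ks
      ≡⟨ cong (length (allowed x ks) +_) (length-forbidden x ks unique positive bounded) ⟨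
    length (allowed x ks) + length (filterᵇ (forbidden ks) (allFin x))
      ≡⟨ +-comm (length (allowed x ks)) _ ⟩
    length (filterᵇ (forbidden ks) (allFin x)) + length (allowed x ks)
      ≡⟨ length-filterᵇ-not (forbidden ks) (allFin x) ⟩
    length (allFin x)
      ≡⟨ length-tabulate (λ i → i) ⟩
    x ∎
    where open ≡-Reasoning

  -- Colouring vertex 0 first

  delete₀ : SimpleGraph (suc n) → SimpleGraph n
  delete₀ G = record
    { adj    = λ i j → adj G (suc i) (suc j)
    ; sym    = λ i j → SimpleGraph.sym G (suc i) (suc j)
    ; irrefl = irrefl G ∘ suc
    }

  -- insert, unlike _∷_, keeps restraints duplicate-free; the price is the correction alreadyForbidden below.
  forbidNeighbours : SimpleGraph (suc n) → Restraint (suc n) → Fin x → Restraint n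
  forbidNeighbours G r c v = if adj G zero (suc v) then insert (colour c) (r (suc v)) else r (suc v)

  module _ (G : SimpleGraph (suc n)) (r : Restraint (suc n)) (c : Fin x) where

    private
      r′ : Restraint n
      r′ = forbidNeighbours G r c

    forbid-∈⁺ : ∀ {v k} → k ∈ r (suc v) → k ∈ r′ v
    forbid-∈⁺ {v} k∈ with adj G zero (suc v)
    ... | true  = ∈-insert⁺ k∈
    ... | false = k∈

    forbid-neighbour : ∀ {v} → T (adj G zero (suc v)) → colour c ∈ r′ v
    forbid-neighbour {v} a with adj G zero (suc v)
    ... | true = ∈-insert {colour c} {r (suc v)}

    forbid-∈⁻ : ∀ {v k} → k ∈ r′ v → k ∈ r (suc v) ⊎ (k ≡ colour c × T (adj G zero (suc v)))
    forbid-∈⁻ {v} k∈ with adj G zero (suc v)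
    ... | false = inj₁ k∈
    ... | true with ∈-insert⁻ k∈
    ...   | inj₁ k≡c  = inj₂ (k≡c , tt)
    ...   | inj₂ k∈rv = inj₁ k∈rv

    forbid-valid : ValidRestraint r → ValidRestraint r′
    forbid-valid valid v with adj G zero (suc v)
    ... | true  = insert-unique (proj₁ (valid (suc v))) , All-insert (s≤s z≤n) (proj₂ (valid (suc v)))
    ... | false = valid (suc v)

    forbid-bounded : Bounded x r → Bounded x r′
    forbid-bounded bounded v with adj G zero (suc v)
    ... | true  = All-insert (toℕ<n c) (bounded (suc v))
    ... | false = bounded (suc v)

    length-forbid : ∀ v → length (r′ v) + 𝟙 (adj G zero (suc v) ∧ forbidden (r (suc v)) c) ≡ length (r (suc v)) + 𝟙 (adj G zero (suc v))
    length-forbid v with adj G zero (suc v)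
    ... | true  = length-insert {colour c} {r (suc v)}
    ... | false = refl

    proper-permitted-∷ : ∀ (cs : Vec (Fin x) n) →
      (Proper G (c ∷ cs) × Permitted r (c ∷ cs)) ⇔ (colour c ∉ r zero × Proper (delete₀ G) cs × Permitted r′ cs)
    proper-permitted-∷ cs = mk⇔
      (λ (proper , permitted) → permitted zero , (λ i j → proper (suc i) (suc j)) , inherit proper permitted)
      (λ (allowed , proper , permitted) → extend proper permitted , λ { zero → allowed ; (suc v) → permitted v ∘ forbid-∈⁺ })
      where
        inherit : Proper G (c ∷ cs) → Permitted r (c ∷ cs) → Permitted r′ cs
        inherit proper permitted v k∈ with forbid-∈⁻ k∈
        ... | inj₁ k∈rv      = permitted (suc v) k∈rv
        ... | inj₂ (k≡c , a) = proper zero (suc v) a (sym (colour-injective k≡c))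
        clash : Permitted r′ cs → ∀ j → T (adj G zero (suc j)) → c ≢ lookup cs j
        clash permitted j a c≡ = permitted j (subst (_∈ r′ j) (cong colour c≡) (forbid-neighbour a))
        extend : Proper (delete₀ G) cs → Permitted r′ cs → Proper G (c ∷ cs)
        extend proper permitted = λ where
          zero    zero    a _ → ⊥-elim (subst T (irrefl G zero) a)
          zero    (suc j) a e → clash permitted j a e
          (suc i) zero    a e → clash permitted i (subst T (SimpleGraph.sym G (suc i) zero) a) (sym e)
          (suc i) (suc j) a e → proper i j a e

  admissible-∷ : (G : SimpleGraph (suc n)) (r : Restraint (suc n)) (c : Fin x) (cs : Vec (Fin x) n) →
    admissible G r (c ∷ cs) ≡ not (forbidden (r zero) c) ∧ admissible (delete₀ G) (forbidNeighbours G r c) cs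
  admissible-∷ G r c cs = does-⇔ (mk⇔ split join) (T? _) (T? _)
    where
      open Equivalence
      split : T (admissible G r (c ∷ cs)) → T (not (forbidden (r zero) c) ∧ admissible (delete₀ G) (forbidNeighbours G r c) cs)
      split t with proper-permitted-∷ G r c cs .to (T-admissible G r (c ∷ cs) .to t)
      ... | allowed , rest = T-∧ {not (forbidden (r zero) c)} .from
              (T-not .from (allowed ∘ toWitness) , T-admissible (delete₀ G) (forbidNeighbours G r c) cs .from rest)
      join : T (not (forbidden (r zero) c) ∧ admissible (delete₀ G) (forbidNeighbours G r c) cs) → T (admissible G r (c ∷ cs))
      join t with T-∧ {not (forbidden (r zero) c)} .to t
      ... | allowed , rest = T-admissible G r (c ∷ cs) .from
              (proper-permitted-∷ G r c cs .from
                (T-not .to allowed ∘ fromWitness , T-admissible (delete₀ G) (forbidNeighbours G r c) cs .to rest))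

  restrainedChromatic-delete₀ : ∀ x (G : SimpleGraph (suc n)) (r : Restraint (suc n)) →
    restrainedChromatic G r x ≡ ∑ (allowed x (r zero)) (λ c → restrainedChromatic (delete₀ G) (forbidNeighbours G r c) x)
  restrainedChromatic-delete₀ {n} x G r = begin
    length (filterᵇ (admissible G r) (concatMap (λ c → map (c ∷_) colourings) (allFin x)))
      ≡⟨ length-filterᵇ-concatMap (admissible G r) _ (allFin x) ⟩
    ∑ (allFin x) (λ c → length (filterᵇ (admissible G r) (map (c ∷_) colourings)))
      ≡⟨ ∑-cong (allFin x) (λ c → length-filterᵇ-map (admissible G r) (c ∷_) colourings) ⟩
    ∑ (allFin x) (λ c → length (filterᵇ (admissible G r ∘ (c ∷_)) colourings))
      ≡⟨ ∑-cong (allFin x) extend-by ⟩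
    ∑ (allFin x) (λ c → 𝟙 (not (forbidden (r zero) c)) * π′ c)
      ≡⟨ ∑-filterᵇ (not ∘ forbidden (r zero)) (allFin x) π′ ⟨
    ∑ (allowed x (r zero)) π′ ∎
    where
      open ≡-Reasoning
      colourings : List (Vec (Fin x) n)
      colourings = allColourings n x
      π′ : Fin x → ℕ
      π′ c = restrainedChromatic (delete₀ G) (forbidNeighbours G r c) x
      extend-by : ∀ c → length (filterᵇ (admissible G r ∘ (c ∷_)) colourings) ≡ 𝟙 (not (forbidden (r zero) c)) * π′ c
      extend-by c = trans (length-filterᵇ-cong colourings (admissible-∷ G r c))
        (length-filterᵇ-∧ (not (forbidden (r zero) c)) (admissible (delete₀ G) (forbidNeighbours G r c)) colourings)

  degree₀ : SimpleGraph (suc n) → ℕ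
  degree₀ {n} G = ∑ (allFin n) (λ v → 𝟙 (adj G zero (suc v)))

  upperEdge : SimpleGraph n → Fin n → Fin n → ℕ
  upperEdge G i j = 𝟙 (⌊ suc (toℕ i) ≤? toℕ j ⌋ ∧ adj G i j)

  edgeCount≡∑∑ : (G : SimpleGraph n) → edgeCount G ≡ ∑ (allFin n) (λ i → ∑ (allFin n) (upperEdge G i))
  edgeCount≡∑∑ {n} G = trans (length-filterᵇ-concatMap _ _ (allFin n))
    (∑-cong (allFin n) λ i → trans (length-filterᵇ-map _ (i ,_) (allFin n)) (length-filterᵇ _ (allFin n)))

  -- Row 0 of upperEdge G contains every neighbour of 0; in the other rows, column 0 lies below the diagonal.
  edgeCount-delete₀ : (G : SimpleGraph (suc n)) → edgeCount G ≡ degree₀ G + edgeCount (delete₀ G)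
  edgeCount-delete₀ {n} G = begin
    edgeCount G
      ≡⟨ edgeCount≡∑∑ G ⟩
    ∑ (allFin (suc n)) (λ i → ∑ (allFin (suc n)) (upperEdge G i))
      ≡⟨ ∑-allFin-suc n _ ⟩
    ∑ (allFin (suc n)) (upperEdge G zero) + ∑ (allFin n) (λ i → ∑ (allFin (suc n)) (upperEdge G (suc i)))
      ≡⟨ cong₂ _+_ (∑-allFin-suc n (upperEdge G zero)) (∑-cong (allFin n) λ i → trans (∑-allFin-suc n (upperEdge G (suc i))) (shift i)) ⟩
    degree₀ G + ∑ (allFin n) (λ i → ∑ (allFin n) (upperEdge (delete₀ G) i))
      ≡⟨ cong (degree₀ G +_) (edgeCount≡∑∑ (delete₀ G)) ⟨
    degree₀ G + edgeCount (delete₀ G)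
      ∎
    where
      open ≡-Reasoning
      ⌊s≤?s⌋ : ∀ m k → ⌊ suc m ≤? suc k ⌋ ≡ ⌊ m ≤? k ⌋
      ⌊s≤?s⌋ m k = trans (isYes≗does _) (trans (does-⇔ (mk⇔ s≤s⁻¹ s≤s) (suc m ≤? suc k) (m ≤? k)) (sym (isYes≗does _)))
      shift : ∀ i → ∑ (allFin n) (upperEdge G (suc i) ∘ suc) ≡ ∑ (allFin n) (upperEdge (delete₀ G) i)
      shift i = ∑-cong (allFin n) λ j → cong (λ b → 𝟙 (b ∧ adj G (suc i) (suc j))) (⌊s≤?s⌋ (suc (toℕ i)) (toℕ j))

  constraints : SimpleGraph n → Restraint n → ℕ
  constraints G r = edgeCount G + restraintSize r

  module _ (G : SimpleGraph (suc n)) (r : Restraint (suc n)) where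

    otherConstraints : ℕ
    otherConstraints = degree₀ G + edgeCount (delete₀ G) + restraintSize (r ∘ suc)

    constraints-delete₀ : constraints G r ≡ length (r zero) + otherConstraints
    constraints-delete₀ = trans (cong₂ _+_ (edgeCount-delete₀ G) (∑-allFin-suc n (length ∘ r)))
      (regroup (degree₀ G) (edgeCount (delete₀ G)) (length (r zero)) (restraintSize (r ∘ suc)))
      where regroup : ∀ d e ρ s → d + e + (ρ + s) ≡ ρ + (d + e + s)
            regroup = solve-∀

    alreadyForbidden : Fin x → ℕ
    alreadyForbidden c = ∑ (allFin n) (λ v → 𝟙 (adj G zero (suc v) ∧ forbidden (r (suc v)) c))

    constraints-forbid : (c : Fin x) → constraints (delete₀ G) (forbidNeighbours G r c) + alreadyForbidden c ≡ otherConstraints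
    constraints-forbid c = begin
      edgeCount (delete₀ G) + restraintSize r′ + alreadyForbidden c       ≡⟨ +-assoc (edgeCount (delete₀ G)) _ _ ⟩
      edgeCount (delete₀ G) + (restraintSize r′ + alreadyForbidden c)     ≡⟨ cong (edgeCount (delete₀ G) +_) (∑-+ (allFin n) _ _) ⟨
      edgeCount (delete₀ G) + ∑ (allFin n) (λ v → length (r′ v) + 𝟙 (adj G zero (suc v) ∧ forbidden (r (suc v)) c))
        ≡⟨ cong (edgeCount (delete₀ G) +_) (trans (∑-cong (allFin n) (length-forbid G r c)) (∑-+ (allFin n) _ _)) ⟩
      edgeCount (delete₀ G) + (restraintSize (r ∘ suc) + degree₀ G)     ≡⟨ regroup (edgeCount (delete₀ G)) (restraintSize (r ∘ suc)) (degree₀ G) ⟩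
      otherConstraints                                                   ∎
      where
        open ≡-Reasoning
        r′ : Restraint n
        r′ = forbidNeighbours G r c
        regroup : ∀ e s d → e + (s + d) ≡ d + e + s
        regroup = solve-∀

    ∑-alreadyForbidden : ∀ {x} → ValidRestraint r → Bounded x r → ∑ (allowed x (r zero)) alreadyForbidden ≤ restraintSize (r ∘ suc)
    ∑-alreadyForbidden {x} valid bounded = begin
      ∑ (allowed x (r zero)) alreadyForbidden            ≤⟨ ∑-filterᵇ-≤ _ (allFin x) alreadyForbidden ⟩
      ∑ (allFin x) alreadyForbidden                      ≡⟨ ∑-swap (allFin x) (allFin n) _ ⟩
      ∑ (allFin n) (λ v → ∑ (allFin x) (λ c → 𝟙 (adj G zero (suc v) ∧ forbidden (r (suc v)) c)))
        ≤⟨ ∑-mono-≤ (allFin n) (λ {v} _ → ∑-mono-≤ (allFin x) (λ {c} _ → 𝟙-∧-≤ʳ (adj G zero (suc v)) _)) ⟩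
      ∑ (allFin n) (λ v → ∑ (allFin x) (𝟙 ∘ forbidden (r (suc v))))
        ≡⟨ ∑-cong (allFin n) count ⟩
      restraintSize (r ∘ suc)                            ∎
      where
        open ≤-Reasoning
        count : ∀ v → ∑ (allFin x) (𝟙 ∘ forbidden (r (suc v))) ≡ length (r (suc v))
        count v = trans (sym (length-filterᵇ (forbidden (r (suc v))) (allFin x)))
          (length-forbidden x (r (suc v)) (proj₁ (valid (suc v))) (proj₂ (valid (suc v))) (bounded (suc v)))

    constraints-forbid-≤ : (c : Fin x) → constraints (delete₀ G) (forbidNeighbours G r c) ≤ constraints G r
    constraints-forbid-≤ c = ≤-trans (m≤m+n _ (alreadyForbidden c))
      (≤-trans (≤-reflexive (constraints-forbid c))
        (≤-trans (m≤n+m _ (length (r zero))) (≤-reflexive (sym constraints-delete₀))))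

  -- Bounds on the restrained chromatic polynomial

  module DeletionStep {n} (G : SimpleGraph (suc n)) (r : Restraint (suc n)) (valid : ValidRestraint r) {x} (bounded : Bounded x r) where

    private
      S : List (Fin x)
      S = allowed x (r zero)
      b ρ N₀ : ℕ
      b = length S
      ρ = length (r zero)
      N₀ = otherConstraints G r
      π′ : Fin x → ℕ
      π′ c = restrainedChromatic (delete₀ G) (forbidNeighbours G r c) x
      N′ : Fin x → ℕ
      N′ c = constraints (delete₀ G) (forbidNeighbours G r c)

      b+ρ≡x : b + ρ ≡ x
      b+ρ≡x = length-allowed x (r zero) (proj₁ (valid zero)) (proj₂ (valid zero)) (bounded zero)

      N′≤N₀ : ∀ c → N′ c ≤ N₀
      N′≤N₀ c = ≤-trans (m≤m+n (N′ c) _) (≤-reflexive (constraints-forbid G r c))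

      N≡ρ+N₀ : constraints G r ≡ ρ + N₀
      N≡ρ+N₀ = constraints-delete₀ G r

    lower-step : (∀ c → x ^ (2 + n) ≤ x * x * π′ c + N′ c * x ^ (1 + n)) →
                 x ^ (3 + n) ≤ x * x * restrainedChromatic G r x + constraints G r * x ^ (2 + n)
    lower-step IH = begin
      x * x ^ (2 + n)                                       ≡⟨ cong (_* x ^ (2 + n)) b+ρ≡x ⟨
      (b + ρ) * x ^ (2 + n)                                 ≡⟨ trans (cong (_+ ρ * x ^ (2 + n)) (∑-const S _)) (sym (*-distribʳ-+ (x ^ (2 + n)) b ρ)) ⟨
      ∑ S (λ _ → x ^ (2 + n)) + ρ * x ^ (2 + n)             ≤⟨ +-monoˡ-≤ _ (∑-mono-≤ S (λ {c} _ → IH c)) ⟩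
      ∑ S (λ c → x * x * π′ c + N′ c * x ^ (1 + n)) + ρ * x ^ (2 + n)
        ≡⟨ cong (_+ _) (∑-linear S (x * x) (x ^ (1 + n)) π′ N′) ⟩
      x * x * ∑ S π′ + ∑ S N′ * x ^ (1 + n) + ρ * x ^ (2 + n)
        ≤⟨ +-monoˡ-≤ (ρ * x ^ (2 + n)) (+-monoʳ-≤ (x * x * ∑ S π′) (*-monoˡ-≤ (x ^ (1 + n)) ΣN′≤xN₀)) ⟩
      x * x * ∑ S π′ + x * N₀ * x ^ (1 + n) + ρ * x ^ (2 + n) ≡⟨ regroup (x * x * ∑ S π′) x N₀ ρ (x ^ (1 + n)) ⟩
      x * x * ∑ S π′ + (ρ + N₀) * x ^ (2 + n)               ≡⟨ cong₂ (λ p N → x * x * p + N * x ^ (2 + n)) (restrainedChromatic-delete₀ x G r) N≡ρ+N₀ ⟨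
      x * x * restrainedChromatic G r x + constraints G r * x ^ (2 + n) ∎
      where
        open ≤-Reasoning
        ΣN′≤xN₀ : ∑ S N′ ≤ x * N₀
        ΣN′≤xN₀ = begin
          ∑ S N′              ≤⟨ ∑-mono-≤ S (λ {c} _ → N′≤N₀ c) ⟩
          ∑ S (λ _ → N₀)      ≡⟨ ∑-const S N₀ ⟩
          b * N₀              ≤⟨ *-monoˡ-≤ N₀ (m+n≤o⇒m≤o b (≤-reflexive b+ρ≡x)) ⟩
          x * N₀              ∎
        regroup : ∀ p x N ρ Y → p + x * N * Y + ρ * (x * Y) ≡ p + (ρ + N) * (x * Y)
        regroup = solve-∀

    upper-step : ∀ K U → constraints G r ≤ U →
      (∀ c → x * x * π′ c + N′ c * x ^ (1 + n) ≤ x ^ (2 + n) + K * x ^ n) →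
      x * x * restrainedChromatic G r x + constraints G r * x ^ (2 + n) ≤ x ^ (3 + n) + (U + U * U + K) * x ^ (1 + n)
    upper-step K U N≤U IH = begin
      x * x * restrainedChromatic G r x + constraints G r * (x * Y)
        ≡⟨ cong₂ (λ p N → x * x * p + N * (x * Y)) (restrainedChromatic-delete₀ x G r) N≡ρ+N₀ ⟩
      x * x * ∑ S π′ + (ρ + N₀) * (x * Y)
        ≡⟨ cong (x * x * ∑ S π′ +_) (split-x (sym b+ρ≡x)) ⟩
      x * x * ∑ S π′ + (ρ * (x * Y) + b * N₀ * Y + ρ * N₀ * Y)
        ≡⟨ cong (λ m → x * x * ∑ S π′ + (ρ * (x * Y) + m * Y + ρ * N₀ * Y)) bN₀≡ΣN′+Σt ⟩
      x * x * ∑ S π′ + (ρ * (x * Y) + (∑ S N′ + Σt) * Y + ρ * N₀ * Y)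
        ≡⟨ regroup (x * x * ∑ S π′) ρ (x * Y) (∑ S N′) Σt N₀ Y ⟩
      (x * x * ∑ S π′ + ∑ S N′ * Y) + (ρ * (x * Y) + (Σt + ρ * N₀) * Y)
        ≡⟨ cong (_+ rest) (∑-linear S (x * x) Y π′ N′) ⟨
      ∑ S (λ c → x * x * π′ c + N′ c * Y) + (ρ * (x * Y) + (Σt + ρ * N₀) * Y)
        ≤⟨ +-monoˡ-≤ rest (∑-mono-≤ S (λ {c} _ → IH c)) ⟩
      ∑ S (λ _ → x * Y + K * Z) + (ρ * (x * Y) + (Σt + ρ * N₀) * Y)
        ≡⟨ cong (_+ rest) (trans (∑-const S _) (*-distribˡ-+ b (x * Y) (K * Z))) ⟩
      (b * (x * Y) + b * (K * Z)) + (ρ * (x * Y) + (Σt + ρ * N₀) * Y)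
        ≤⟨ +-monoˡ-≤ rest (+-monoʳ-≤ (b * (x * Y)) (*-monoˡ-≤ (K * Z) (m+n≤o⇒m≤o b (≤-reflexive b+ρ≡x)))) ⟩
      (b * (x * Y) + x * (K * Z)) + (ρ * (x * Y) + (Σt + ρ * N₀) * Y)
        ≡⟨ collect b ρ x K Z (Σt + ρ * N₀) ⟩
      (b + ρ) * (x * Y) + ((Σt + ρ * N₀) + K) * Y
        ≤⟨ +-mono-≤ (≤-reflexive (cong (_* (x * Y)) b+ρ≡x)) (*-monoˡ-≤ Y (+-monoˡ-≤ K Σt+ρN₀≤U+U²)) ⟩
      x * (x * Y) + (U + U * U + K) * Y ∎
      where
        open ≤-Reasoning
        Z Y Σt rest : ℕ
        Z = x ^ n
        Y = x ^ (1 + n)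
        Σt = ∑ S (alreadyForbidden G r)
        rest = ρ * (x * Y) + (Σt + ρ * N₀) * Y
        split-x : ∀ {x} → x ≡ b + ρ → (ρ + N₀) * (x * Y) ≡ ρ * (x * Y) + b * N₀ * Y + ρ * N₀ * Y
        split-x refl = expand ρ N₀ b Y
          where expand : ∀ ρ N₀ b Y → (ρ + N₀) * ((b + ρ) * Y) ≡ ρ * ((b + ρ) * Y) + b * N₀ * Y + ρ * N₀ * Y
                expand = solve-∀
        bN₀≡ΣN′+Σt : b * N₀ ≡ ∑ S N′ + Σt
        bN₀≡ΣN′+Σt = begin-equality
          b * N₀                                              ≡⟨ ∑-const S N₀ ⟨
          ∑ S (λ _ → N₀)                                      ≡⟨ ∑-cong S (constraints-forbid G r) ⟨
          ∑ S (λ c → N′ c + alreadyForbidden G r c)           ≡⟨ ∑-+ S N′ _ ⟩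
          ∑ S N′ + Σt                                         ∎
        regroup : ∀ p ρ xY ΣN Σt N₀ Y → p + (ρ * xY + (ΣN + Σt) * Y + ρ * N₀ * Y) ≡ (p + ΣN * Y) + (ρ * xY + (Σt + ρ * N₀) * Y)
        regroup = solve-∀
        collect : ∀ b ρ x K Z c → (b * (x * (x * Z)) + x * (K * Z)) + (ρ * (x * (x * Z)) + c * (x * Z))
                                 ≡ (b + ρ) * (x * (x * Z)) + (c + K) * (x * Z)
        collect = solve-∀
        ρ+N₀≤U : ρ + N₀ ≤ U
        ρ+N₀≤U = ≤-trans (≤-reflexive (sym N≡ρ+N₀)) N≤U
        N₀≤U : N₀ ≤ U
        N₀≤U = ≤-trans (m≤n+m N₀ ρ) ρ+N₀≤U
        Σt+ρN₀≤U+U² : Σt + ρ * N₀ ≤ U + U * U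
        Σt+ρN₀≤U+U² = +-mono-≤
          (≤-trans (∑-alreadyForbidden G r valid bounded) (≤-trans (m≤n+m _ (degree₀ G + edgeCount (delete₀ G))) N₀≤U))
          (*-mono-≤ (≤-trans (m≤m+n ρ N₀) ρ+N₀≤U) N₀≤U)

  -- x^n − N x^(n−1) ≤ π_r(G, x) ≤ x^n − N x^(n−1) + K x^(n−2), multiplied by x² to keep exponents natural.
  lower-bound : ∀ n (G : SimpleGraph n) r → ValidRestraint r → ∀ {x} → Bounded x r →
    x ^ (2 + n) ≤ x * x * restrainedChromatic G r x + constraints G r * x ^ (1 + n)
  lower-bound zero    G r valid {x} bounded = ≤-reflexive (square x)
    where square : ∀ x → x * (x * 1) ≡ x * x * 1 + 0 * (x * 1)
          square = solve-∀
  lower-bound (suc n) G r valid bounded = DeletionStep.lower-step G r valid bounded λ c →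
    lower-bound n (delete₀ G) (forbidNeighbours G r c) (forbid-valid G r c valid) (forbid-bounded G r c bounded)

  upper-bound : ∀ n U (G : SimpleGraph n) r → ValidRestraint r → constraints G r ≤ U → ∀ {x} → Bounded x r →
    x * x * restrainedChromatic G r x + constraints G r * x ^ (1 + n) ≤ x ^ (2 + n) + n * (U + U * U) * x ^ n
  upper-bound zero    U G r valid N≤U {x} bounded = ≤-reflexive (square x)
    where square : ∀ x → x * x * 1 + 0 * (x * 1) ≡ x * (x * 1) + 0 * 1
          square = solve-∀
  upper-bound (suc n) U G r valid N≤U bounded = DeletionStep.upper-step G r valid bounded (n * (U + U * U)) U N≤U λ c →
    upper-bound n U (delete₀ G) (forbidNeighbours G r c) (forbid-valid G r c valid)
      (≤-trans (constraints-forbid-≤ G r c) N≤U) (forbid-bounded G r c bounded)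

open Polynomials using (DegreeBelow; degreeBelow-sandwich; degreeBelow-congᵉ; signedPoly-subleading; pos-^)
open Chromatic using (constraints; maxRestraint-bounded; lower-bound; upper-bound)

open import Data.Nat using (ℕ; suc; _+_; _*_; _^_; _∸_; _≤_)
open import Data.Nat.Properties using (≤-refl)
open import Data.Integer as ℤ using (ℤ; +_)
open import Data.Integer.Properties using (pos-+; pos-*)
open import Data.Integer.Tactic.RingSolver using (solve-∀)
open import Relation.Binary.PropositionalEquality

restrainedChromatic-expansion : ∀ {m} (G : SimpleGraph (suc m)) r → ValidRestraint r →
  DegreeBelow m (λ x → + restrainedChromatic G r x ℤ.- (+ x) ℤ.^ suc m ℤ.+ + constraints G r ℤ.* (+ x) ℤ.^ m)
restrainedChromatic-expansion {m} G r valid =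
  degreeBelow-sandwich A B (suc m * (N + N * N)) (maxRestraint r)
    (λ x max≤x → lower-bound (suc m) G r valid (maxRestraint-bounded r max≤x))
    (λ x max≤x → upper-bound (suc m) N G r valid ≤-refl (maxRestraint-bounded r max≤x))
    (λ x → trans (cong₂ ℤ._-_ (cast x) (pos-^ x (3 + m))) (factor (+ x) (+ π x) (+ N) ((+ x) ℤ.^ m)))
  where
    N : ℕ
    N = constraints G r
    π A B : ℕ → ℕ
    π x = restrainedChromatic G r x
    A x = x * x * π x + N * x ^ (2 + m)
    B x = x ^ (3 + m)
    cast : ∀ x → + A x ≡ + x ℤ.* + x ℤ.* + π x ℤ.+ + N ℤ.* (+ x) ℤ.^ (2 + m)
    cast x = trans (pos-+ (x * x * π x) _)
      (cong₂ ℤ._+_ (trans (pos-* (x * x) (π x)) (cong (ℤ._* + π x) (pos-* x x)))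
                   (trans (pos-* N _) (cong (+ N ℤ.*_) (pos-^ x (2 + m)))))
    factor : ∀ X P N Y → X ℤ.* X ℤ.* P ℤ.+ N ℤ.* (X ℤ.* (X ℤ.* Y)) ℤ.- X ℤ.* (X ℤ.* (X ℤ.* Y))
                         ≡ X ℤ.* (X ℤ.* (P ℤ.- X ℤ.* Y ℤ.+ N ℤ.* Y))
    factor = solve-∀

theorem3p1 : (n : ℕ) → 1 ≤ n → (G : SimpleGraph n) → (r : Restraint n) → ValidRestraint r →
    (a : ℕ → ℤ) →
    (∀ x → maxRestraint r ≤ x → + (restrainedChromatic G r x) ≡ signedPoly n a (+ x)) →
    a (n ∸ 1) ≡ + (edgeCount G + restraintSize r)
theorem3p1 (suc m) _ G r valid a agrees =
  signedPoly-subleading m a (constraints G r)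
    (degreeBelow-congᵉ (maxRestraint r)
      (λ x max≤x → cong (λ p → p ℤ.- (+ x) ℤ.^ suc m ℤ.+ + constraints G r ℤ.* (+ x) ℤ.^ m) (agrees x max≤x))
      (restrainedChromatic-expansion G r valid))
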